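{- Let $n\geq 5$ be an integer. There exists an infinite set $\mathcal{G}$ of triples of rational numbers with the property that if $(a,b,c)\in\mathcal{G}$, then there are infinitely many $(n-3)$-tuples of rational numbers $(t_{0},\ldots,t_{n-4})$ such that all roots of the polynomial \[ X^n+aX^{n-1}+bX^{n-2}+cX^{n-3}+\sum_{i=0}^{n-4}t_{i}X^{i} \] are rational. -}

module Defs where

open import Data.Nat using (ℕ; zero; suc)
open import Data.Rational using (ℚ; 0ℚ; 1ℚ; _+_; _*_; -_)
open import Data.List using (List; []; _∷_; map)
open import Data.Vec using (Vec; []; _∷_)
open import Data.Product using (_×_)
open import Relation.Binary.PropositionalEquality using (_≡_)

-- Polynomials over ℚ as coefficient lists, lowest degree first:
-- c₀ ∷ c₁ ∷ … ∷ cₖ  represents  c₀ + c₁ X + … + cₖ Xᵏ.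
Poly : Set
Poly = List ℚ

addP : Poly → Poly → Poly
addP []       q        = q
addP p        []       = p
addP (a ∷ p)  (b ∷ q)  = (a + b) ∷ addP p q

mulP : Poly → Poly → Poly
mulP []      q = []
mulP (a ∷ p) q = addP (map (a *_) q) (0ℚ ∷ mulP p q)

prodLinear : ∀ {n} → Vec ℚ n → Poly
prodLinear []       = 1ℚ ∷ []
prodLinear (r ∷ rs) = mulP ((- r) ∷ 1ℚ ∷ []) (prodLinear rs)

AllRootsRational : (n : ℕ) → Poly → Set
AllRootsRational n p = Data.Product.∃ λ (r : Vec ℚ n) → prodLinear r ≡ p

-- A function ℕ → A that is injective: witnesses an infinite family.
InjectiveSeq : {A : Set} → (ℕ → A) → Set
InjectiveSeq f = ∀ i j → f i ≡ f j → i ≡ j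

{-# OPTIONS --safe #-}

-- If u² + v² = 1 then (X - w)(X² - u²)(X² - v²) = X⁵ - wX⁴ - X³ + wX² + u²v²X - wu²v², so every
-- triple (a, b, c) = (-w, -1, w) works once the polynomial is multiplied by X^(n-5): the remaining
-- coefficients are (0, …, 0, -wu²v², u²v²). Rational points (u, v) of the unit circle come from
-- rational slopes t, and along t = 3, 4, 5, … the value u²v² = v²(1 - v²) strictly decreases,
-- because v = 2t/(1 + t²) decreases and v² stays where x ↦ x(1 - x) is increasing.

module Submission where

open import Defs
open import Data.Nat using (ℕ; _≤_; _∸_)
open import Data.Rational using (ℚ; 1ℚ)
open import Data.List using (_∷_; []; _++_)
open import Data.Vec using (Vec; toList)
open import Data.Product using (Σ; _×_; _,_)

import Data.Integer as ℤ
import Data.Integer.Properties as ℤ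
import Data.List as List
import Data.List.Properties as List
import Data.List.Relation.Binary.Pointwise as Pointwise
import Data.Nat as ℕ
import Data.Nat.Properties as ℕ
import Data.Vec as Vec
import Data.Vec.Properties as Vec
open import Data.Product using (proj₂)
open import Data.Rational
  using (0ℚ; _+_; _*_; -_; _-_; _<_; _>_; 1/_; ↥_; *<*; positive; nonNegative; nonPositive; >-nonZero)
  renaming (_≤_ to _≤ℚ_)
open import Data.Rational.Literals using (fromℤ)
open import Data.Rational.Properties
open import Data.Sum using (inj₁; inj₂)
open import Data.Unit using (tt)
open import Function using (_∘_)
open import Level using (0ℓ)
open import Relation.Binary.Core using (_Preserves_⟶_)
open import Relation.Binary.Definitions using (tri<; tri≈; tri>)
open import Relation.Binary.PropositionalEquality
open import Relation.Nullary.Decidable using (dec⇒maybe; toWitness)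
open import Relation.Nullary.Negation using (contradiction)
open import Tactic.RingSolver using (solve; solve-∀)
open import Tactic.RingSolver.Core.AlmostCommutativeRing using (AlmostCommutativeRing; fromCommutativeRing)

open ≡-Reasoning

ring : AlmostCommutativeRing 0ℓ 0ℓ
ring = fromCommutativeRing +-*-commutativeRing (λ x → dec⇒maybe (0ℚ ≟ x))

addP-identityʳ : ∀ p → addP p [] ≡ p
addP-identityʳ []      = refl
addP-identityʳ (_ ∷ _) = refl

addP-0* : ∀ p x → addP (List.map (0ℚ *_) p) (x ∷ p) ≡ x ∷ p
addP-0* []      x = refl
addP-0* (y ∷ p) x = cong₂ _∷_ (trans (cong (_+ x) (*-zeroˡ y)) (+-identityˡ x)) (addP-0* p y)

mulP-1 : ∀ x p → mulP (1ℚ ∷ []) (x ∷ p) ≡ x ∷ p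
mulP-1 x p = cong₂ _∷_ (trans (+-identityʳ (1ℚ * x)) (*-identityˡ x)) (begin
  addP (List.map (1ℚ *_) p) []  ≡⟨ addP-identityʳ _ ⟩
  List.map (1ℚ *_) p            ≡⟨ List.map-cong *-identityˡ p ⟩
  List.map (λ y → y) p          ≡⟨ List.map-id p ⟩
  p                             ∎)

mulP-X : ∀ x p → mulP (- 0ℚ ∷ 1ℚ ∷ []) (x ∷ p) ≡ 0ℚ ∷ x ∷ p
mulP-X x p = begin
  addP (List.map (0ℚ *_) (x ∷ p)) (0ℚ ∷ mulP (1ℚ ∷ []) (x ∷ p))
    ≡⟨ cong (λ q → addP (List.map (0ℚ *_) (x ∷ p)) (0ℚ ∷ q)) (mulP-1 x p) ⟩
  addP (List.map (0ℚ *_) (x ∷ p)) (0ℚ ∷ x ∷ p)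
    ≡⟨ addP-0* (x ∷ p) 0ℚ ⟩
  0ℚ ∷ x ∷ p ∎

-- mulP-X applies to non-empty lists, and a product by X - r is never [].
prodLinear-0∷ : ∀ {n} (rs : Vec ℚ n) → prodLinear (0ℚ Vec.∷ rs) ≡ 0ℚ ∷ prodLinear rs
prodLinear-0∷ Vec.[]       = mulP-X 1ℚ []
prodLinear-0∷ (r Vec.∷ rs) with prodLinear rs
... | []    = mulP-X 0ℚ (0ℚ ∷ [])
... | _ ∷ _ = mulP-X _ _

prodLinear-zeros++ : ∀ j {n} (rs : Vec ℚ n) →
  prodLinear (Vec.replicate j 0ℚ Vec.++ rs) ≡ List.replicate j 0ℚ ++ prodLinear rs
prodLinear-zeros++ ℕ.zero    rs = refl
prodLinear-zeros++ (ℕ.suc j) rs =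
  trans (prodLinear-0∷ (Vec.replicate j 0ℚ Vec.++ rs)) (cong (0ℚ ∷_) (prodLinear-zeros++ j rs))

allRootsRational-*Xʲ : ∀ j {n p} → AllRootsRational n p →
  AllRootsRational (n ℕ.+ j) (List.replicate j 0ℚ ++ p)
allRootsRational-*Xʲ j {n} {p} (rs , refl) =
  subst (λ k → AllRootsRational k (List.replicate j 0ℚ ++ p)) (ℕ.+-comm j n)
    (Vec.replicate j 0ℚ Vec.++ rs , prodLinear-zeros++ j rs)

shiftCoeffs : ∀ j {n} → Vec ℚ n → Vec ℚ (n ℕ.+ j)
shiftCoeffs j {n} xs = Vec.cast (ℕ.+-comm j n) (Vec.replicate j 0ℚ Vec.++ xs)

toList-shiftCoeffs : ∀ j {n} (xs : Vec ℚ n) →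
  toList (shiftCoeffs j xs) ≡ List.replicate j 0ℚ ++ toList xs
toList-shiftCoeffs j xs = begin
  toList (shiftCoeffs j xs)                          ≡⟨ Vec.toList-cast _ _ ⟩
  toList (Vec.replicate j 0ℚ Vec.++ xs)              ≡⟨ Vec.toList-++ _ xs ⟩
  toList (Vec.replicate j 0ℚ) ++ toList xs           ≡⟨ cong (_++ toList xs) (Vec.toList-replicate j 0ℚ) ⟩
  List.replicate j 0ℚ ++ toList xs                   ∎

shiftCoeffs-injective : ∀ j {n} {xs ys : Vec ℚ n} → shiftCoeffs j xs ≡ shiftCoeffs j ys → xs ≡ ys
shiftCoeffs-injective j {xs = xs} {ys} eq =
  trans (sym (Vec.cast-is-id refl xs)) (Vec.toList-injective refl xs ys
    (List.++-cancelˡ (List.replicate j 0ℚ) _ _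
      (trans (sym (toList-shiftCoeffs j xs)) (trans (cong toList eq) (toList-shiftCoeffs j ys)))))

allRootsRational-shiftCoeffs : ∀ j {m n} (xs : Vec ℚ n) p → AllRootsRational m (toList xs ++ p) →
  AllRootsRational (m ℕ.+ j) (toList (shiftCoeffs j xs) ++ p)
allRootsRational-shiftCoeffs j xs p roots = subst (AllRootsRational _)
  (trans (sym (List.++-assoc (List.replicate j 0ℚ) (toList xs) p))
         (cong (_++ p) (sym (toList-shiftCoeffs j xs))))
  (allRootsRational-*Xʲ j roots)

prodLinear-quintic : ∀ w u v →
  prodLinear (w Vec.∷ u Vec.∷ - u Vec.∷ v Vec.∷ - v Vec.∷ Vec.[]) ≡
    - w * (u * u * (v * v)) ∷ u * u * (v * v) ∷ w * (u * u + v * v) ∷ - (u * u + v * v) ∷ - w ∷ 1ℚ ∷ []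
prodLinear-quintic w u v = Pointwise.Pointwise-≡⇒≡
  ( solve (w ∷ u ∷ v ∷ []) ring Pointwise.∷ solve (w ∷ u ∷ v ∷ []) ring
  Pointwise.∷ solve (w ∷ u ∷ v ∷ []) ring Pointwise.∷ solve (w ∷ u ∷ v ∷ []) ring
  Pointwise.∷ solve (w ∷ u ∷ v ∷ []) ring Pointwise.∷ solve (w ∷ u ∷ v ∷ []) ring
  Pointwise.∷ Pointwise.[])

allRootsRational-quintic : ∀ w u v → u * u + v * v ≡ 1ℚ →
  AllRootsRational 5 (- w * (u * u * (v * v)) ∷ u * u * (v * v) ∷ w ∷ - 1ℚ ∷ - w ∷ 1ℚ ∷ [])
allRootsRational-quintic w u v u²+v²≡1 = w Vec.∷ u Vec.∷ - u Vec.∷ v Vec.∷ - v Vec.∷ Vec.[] , (begin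
  prodLinear (w Vec.∷ u Vec.∷ - u Vec.∷ v Vec.∷ - v Vec.∷ Vec.[])
    ≡⟨ prodLinear-quintic w u v ⟩
  - w * e ∷ e ∷ w * (u * u + v * v) ∷ - (u * u + v * v) ∷ - w ∷ 1ℚ ∷ []
    ≡⟨ cong (λ s → - w * e ∷ e ∷ w * s ∷ - s ∷ - w ∷ 1ℚ ∷ []) u²+v²≡1 ⟩
  - w * e ∷ e ∷ w * 1ℚ ∷ - 1ℚ ∷ - w ∷ 1ℚ ∷ []
    ≡⟨ cong (λ c → - w * e ∷ e ∷ c ∷ - 1ℚ ∷ - w ∷ 1ℚ ∷ []) (*-identityʳ w) ⟩
  - w * e ∷ e ∷ w ∷ - 1ℚ ∷ - w ∷ 1ℚ ∷ [] ∎)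
  where
  e : ℚ
  e = u * u * (v * v)

≡-modulo : ∀ {a b} c {d} → a ≡ b + c * (d - 1ℚ) → d ≡ 1ℚ → a ≡ b
≡-modulo {b = b} c a≡ refl = trans a≡ (vanish b c)
  where
  vanish : ∀ b c → b + c * (1ℚ - 1ℚ) ≡ b
  vanish = solve-∀ ring

positive-gap⇒< : ∀ {p q d} → 0ℚ < d → q ≡ p + d → p < q
positive-gap⇒< {p} 0<d refl = subst (_< p + _) (+-identityʳ p) (+-monoʳ-< p 0<d)

p<q⇒0<q-p : ∀ {p q} → p < q → 0ℚ < q - p
p<q⇒0<q-p {p} {q} p<q = subst (_< q - p) (+-inverseʳ p) (+-monoˡ-< (- p) p<q)

0<p*q : ∀ {p q} → 0ℚ < p → 0ℚ < q → 0ℚ < p * q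
0<p*q {p} {q} 0<p 0<q = positive⁻¹ (p * q) {{pos*pos⇒pos p {{positive 0<p}} q {{positive 0<q}}}}

0≤p*p : ∀ p → 0ℚ ≤ℚ p * p
0≤p*p p with ≤-total 0ℚ p
... | inj₁ 0≤p = nonNegative⁻¹ (p * p) {{nonNeg*nonNeg⇒nonNeg p {{nonNegative 0≤p}} p {{nonNegative 0≤p}}}}
... | inj₂ p≤0 = nonNegative⁻¹ (p * p) {{nonPos*nonPos⇒nonPos p {{nonPositive p≤0}} p {{nonPositive p≤0}}}}

*-self-≤ : ∀ {p q} → 0ℚ ≤ℚ p → p ≤ℚ q → p * p ≤ℚ q * q
*-self-≤ {p} {q} 0≤p p≤q = ≤-trans (*-monoˡ-≤-nonNeg p {{nonNegative 0≤p}} p≤q)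
                                   (*-monoʳ-≤-nonNeg q {{nonNegative (≤-trans 0≤p p≤q)}} p≤q)

*-self-< : ∀ {p q} → 0ℚ ≤ℚ p → p < q → p * p < q * q
*-self-< {p} {q} 0≤p p<q = ≤-<-trans (*-monoˡ-≤-nonNeg p {{nonNegative 0≤p}} (<⇒≤ p<q))
                                     (*-monoˡ-<-pos q {{positive (≤-<-trans 0≤p p<q)}} p<q)

logistic : ℚ → ℚ
logistic x = x * (1ℚ - x)

logistic-strictMono : ∀ {x y} → x < y → x + y < 1ℚ → logistic x < logistic y
logistic-strictMono {x} {y} x<y x+y<1 =
  positive-gap⇒< (0<p*q (p<q⇒0<q-p x<y) (p<q⇒0<q-p x+y<1)) (gap x y)
  where
  gap : ∀ x y → y * (1ℚ - y) ≡ x * (1ℚ - x) + (y - x) * (1ℚ - (x + y))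
  gap = solve-∀ ring

StrictlyDecreasing : (ℕ → ℚ) → Set
StrictlyDecreasing f = f Preserves ℕ._<_ ⟶ _>_

strictlyDecreasing⇒≤head : ∀ {f} → StrictlyDecreasing f → ∀ m → f m ≤ℚ f 0
strictlyDecreasing⇒≤head f↓ ℕ.zero    = ≤-refl
strictlyDecreasing⇒≤head f↓ (ℕ.suc m) = <⇒≤ (f↓ ℕ.z<s)

strictlyDecreasing⇒injective : ∀ {f} → StrictlyDecreasing f → InjectiveSeq f
strictlyDecreasing⇒injective f↓ i j fi≡fj with ℕ.<-cmp i j
... | tri< i<j _ _ = contradiction (sym fi≡fj) (<⇒≢ (f↓ i<j))
... | tri≈ _ i≡j _ = i≡j
... | tri> _ _ j<i = contradiction fi≡fj (<⇒≢ (f↓ j<i))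

1+t²>0 : ∀ t → 0ℚ < 1ℚ + t * t
1+t²>0 t = +-mono-<-≤ (positive⁻¹ 1ℚ) (0≤p*p t)

1/[1+t²] : ℚ → ℚ
1/[1+t²] t = (1/ (1ℚ + t * t)) {{>-nonZero (1+t²>0 t)}}

1/[1+t²]-inverse : ∀ t → 1/[1+t²] t * (1ℚ + t * t) ≡ 1ℚ
1/[1+t²]-inverse t = *-inverseˡ (1ℚ + t * t) {{>-nonZero (1+t²>0 t)}}

1/[1+t²]>0 : ∀ t → 0ℚ < 1/[1+t²] t
1/[1+t²]>0 t = positive⁻¹ (1/[1+t²] t) {{1/pos⇒pos (1ℚ + t * t) {{positive (1+t²>0 t)}}}}

-- The rational parametrisation ((t² - 1)/(t² + 1), 2t/(t² + 1)) of the unit circle.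
circleX circleY : ℚ → ℚ
circleX t = 1ℚ - (1/[1+t²] t + 1/[1+t²] t)
circleY t = (t + t) * 1/[1+t²] t

circle-equation : ∀ t → circleX t * circleX t + circleY t * circleY t ≡ 1ℚ
circle-equation t = ≡-modulo (z + z + z + z) (identity t z) (1/[1+t²]-inverse t)
  where
  z : ℚ
  z = 1/[1+t²] t
  identity : ∀ t z → (1ℚ - (z + z)) * (1ℚ - (z + z)) + (t + t) * z * ((t + t) * z)
                     ≡ 1ℚ + (z + z + z + z) * (z * (1ℚ + t * t) - 1ℚ)
  identity = solve-∀ ring

circleY>0 : ∀ {t} → 0ℚ < t → 0ℚ < circleY t
circleY>0 {t} 0<t = 0<p*q (+-mono-< 0<t 0<t) (1/[1+t²]>0 t)

circleY-antitone : ∀ {s t} → 1ℚ ≤ℚ s → s < t → circleY t < circleY s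
circleY-antitone {s} {t} 1≤s s<t = positive-gap⇒< gap>0 (begin
  circleY s                                        ≡⟨ sym (*-identityʳ ((s + s) * z s)) ⟩
  (s + s) * z s * 1ℚ                               ≡⟨ cong ((s + s) * z s *_) (sym (1/[1+t²]-inverse t)) ⟩
  (s + s) * z s * (z t * (1ℚ + t * t))             ≡⟨ identity s t (z s) (z t) ⟩
  (t + t) * z t * (z s * (1ℚ + s * s)) + gap       ≡⟨ cong (λ c → (t + t) * z t * c + gap) (1/[1+t²]-inverse s) ⟩
  (t + t) * z t * 1ℚ + gap                         ≡⟨ cong (_+ gap) (*-identityʳ ((t + t) * z t)) ⟩
  circleY t + gap                                  ∎)
  where
  z : ℚ → ℚ
  z = 1/[1+t²]
  gap : ℚ
  gap = (z s + z s) * z t * ((t - s) * (s * t - 1ℚ))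
  identity : ∀ s t a b → (s + s) * a * (b * (1ℚ + t * t))
                         ≡ (t + t) * b * (a * (1ℚ + s * s)) + (a + a) * b * ((t - s) * (s * t - 1ℚ))
  identity = solve-∀ ring
  1<t : 1ℚ < t
  1<t = ≤-<-trans 1≤s s<t
  1<st : 1ℚ < s * t
  1<st = <-≤-trans 1<t (subst (_≤ℚ s * t) (*-identityˡ t)
           (*-monoʳ-≤-nonNeg t {{nonNegative (≤-trans (<⇒≤ (positive⁻¹ 1ℚ)) (<⇒≤ 1<t))}} 1≤s))
  gap>0 : 0ℚ < gap
  gap>0 = 0<p*q (0<p*q (+-mono-< (1/[1+t²]>0 s) (1/[1+t²]>0 s)) (1/[1+t²]>0 t))
                (0<p*q (p<q⇒0<q-p s<t) (p<q⇒0<q-p 1<st))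

squareProduct : ℚ → ℚ
squareProduct t = circleX t * circleX t * (circleY t * circleY t)

squareProduct≡logistic : ∀ t → squareProduct t ≡ logistic (circleY t * circleY t)
squareProduct≡logistic t = begin
  x² * y²          ≡⟨ cong (_* y²) (trans (a≡a+b-b x² y²) (cong (_- y²) (circle-equation t))) ⟩
  (1ℚ - y²) * y²   ≡⟨ *-comm _ y² ⟩
  logistic y²      ∎
  where
  x² y² : ℚ
  x² = circleX t * circleX t
  y² = circleY t * circleY t
  a≡a+b-b : ∀ a b → a ≡ a + b - b
  a≡a+b-b = solve-∀ ring

ι : ℕ → ℚ
ι k = fromℤ (ℤ.+ k)

ι-injective : InjectiveSeq ι
ι-injective i j ιi≡ιj = ℤ.+-injective (cong ↥_ ιi≡ιj)

ι-strictMono : ι Preserves ℕ._<_ ⟶ _<_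
ι-strictMono {i} {j} i<j =
  *<* (subst₂ ℤ._<_ (sym (ℤ.*-identityʳ (ℤ.+ i))) (sym (ℤ.*-identityʳ (ℤ.+ j))) (ℤ.+<+ i<j))

-- Starting at 3 keeps circleY² below 1/2, where logistic is increasing.
slope : ℕ → ℚ
slope m = ι (3 ℕ.+ m)

circleY∘slope-decreasing : StrictlyDecreasing (circleY ∘ slope)
circleY∘slope-decreasing i<j =
  circleY-antitone (<⇒≤ (ι-strictMono (ℕ.s≤s (ℕ.s≤s ℕ.z≤n)))) (ι-strictMono (ℕ.+-monoʳ-< 3 i<j))

squareProduct∘slope-decreasing : StrictlyDecreasing (squareProduct ∘ slope)
squareProduct∘slope-decreasing {i} {j} i<j =
  subst₂ _<_ (sym (squareProduct≡logistic (slope j))) (sym (squareProduct≡logistic (slope i)))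
    (logistic-strictMono (*-self-< (<⇒≤ (y>0 j)) (circleY∘slope-decreasing i<j))
                         (≤-<-trans (+-mono-≤ (y²≤y₀² j) (y²≤y₀² i)) y₀²+y₀²<1))
  where
  y : ℕ → ℚ
  y = circleY ∘ slope
  y>0 : ∀ m → 0ℚ < y m
  y>0 m = circleY>0 (ι-strictMono {0} {3 ℕ.+ m} ℕ.z<s)
  y²≤y₀² : ∀ m → y m * y m ≤ℚ y 0 * y 0
  y²≤y₀² m = *-self-≤ (<⇒≤ (y>0 m)) (strictlyDecreasing⇒≤head circleY∘slope-decreasing m)
  y₀²+y₀²<1 : y 0 * y 0 + y 0 * y 0 < 1ℚ
  y₀²+y₀²<1 = toWitness {a? = y 0 * y 0 + y 0 * y 0 <? 1ℚ} tt

mainTheorem9 : (n : ℕ) → 5 ≤ n →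
    Σ (ℕ → ℚ × ℚ × ℚ) λ G → InjectiveSeq G ×
      ((k : ℕ) → let (a , b , c) = G k in
        Σ (ℕ → Vec ℚ (n ∸ 3)) λ T → InjectiveSeq T ×
          ((m : ℕ) → AllRootsRational n (toList (T m) ++ (c ∷ b ∷ a ∷ 1ℚ ∷ []))))
mainTheorem9 _ (ℕ.s≤s (ℕ.s≤s (ℕ.s≤s (ℕ.s≤s (ℕ.s≤s (ℕ.z≤n {j})))))) =
  G , G-injective , λ k → coefficients (ι k) , coefficients-injective (ι k) , roots (ι k)
  where
  G : ℕ → ℚ × ℚ × ℚ
  G k = - ι k , - 1ℚ , ι k

  G-injective : InjectiveSeq G
  G-injective i i′ eq = ι-injective i i′ (cong (proj₂ ∘ proj₂) eq)

  e : ℕ → ℚ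
  e m = squareProduct (slope m)

  coefficients : ℚ → ℕ → Vec ℚ (2 ℕ.+ j)
  coefficients w m = shiftCoeffs j (- w * e m Vec.∷ e m Vec.∷ Vec.[])

  coefficients-injective : ∀ w → InjectiveSeq (coefficients w)
  coefficients-injective w i i′ eq = strictlyDecreasing⇒injective squareProduct∘slope-decreasing i i′
    (Vec.∷-injectiveˡ (Vec.∷-injectiveʳ (shiftCoeffs-injective j eq)))

  roots : ∀ w m → AllRootsRational (5 ℕ.+ j) (toList (coefficients w m) ++ w ∷ - 1ℚ ∷ - w ∷ 1ℚ ∷ [])
  roots w m = allRootsRational-shiftCoeffs j (- w * e m Vec.∷ e m Vec.∷ Vec.[]) (w ∷ - 1ℚ ∷ - w ∷ 1ℚ ∷ [])
    (allRootsRational-quintic w (circleX (slope m)) (circleY (slope m)) (circle-equation (slope m)))
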